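{- Let $n\ge 3$ be odd with $3\nmid n$. Then every cardioidal starter of order $n$ is skew.
   Context: A starter in $\mathbb{Z}_n$ ($n$ odd) is a partition of $\mathbb{Z}_n\setminus\{0\}$ into $(n-1)/2$ pairs $\{s_i,t_i\}$ such that the elements $\pm(s_i-t_i)$ are exactly the non-zero elements of $\mathbb{Z}_n$; it is strong if the sums $s_i+t_i$ are non-zero and pairwise distinct, and skew if it is strong and the elements $\pm(s_i+t_i)$, $i=1,\dots,(n-1)/2$, are exactly the non-zero elements of $\mathbb{Z}_n$. A starter is cardioidal if every pair has the form $\{i,2i\bmod n\}$ for some $i\in\mathbb{Z}_n\setminus\{0\}$. -}

module Defs where

open import Data.Nat using (ℕ; zero; suc; _+_; _*_; _∸_; _<_)
open import Data.Nat.DivMod using (_%_)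
open import Data.List using (List; []; _∷_; map; concatMap; upTo)
open import Data.List.Relation.Unary.All using (All)
open import Data.List.Relation.Unary.Unique.Propositional using (Unique)
open import Data.List.Relation.Binary.Permutation.Propositional using (_↭_)
open import Data.Product using (_×_; _,_; ∃)
open import Data.Sum using (_⊎_)
open import Relation.Binary.PropositionalEquality using (_≡_; _≢_)

-- Elements of ℤ_n are represented by their canonical representatives 0,…,n-1 (in ℕ).
-- Reduction mod n (n = 0 never occurs in the statement, since n ≥ 3).
mod : ℕ → ℕ → ℕ
mod a zero    = a
mod a (suc m) = a % suc m

addₙ : ℕ → ℕ → ℕ → ℕ
addₙ n a b = mod (a + b) n

negₙ : ℕ → ℕ → ℕ
negₙ n a = mod (n ∸ a) n

subₙ : ℕ → ℕ → ℕ → ℕ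
subₙ n a b = addₙ n a (negₙ n b)

nonzeroₙ : ℕ → List ℕ
nonzeroₙ n = map suc (upTo (n ∸ 1))

Pairs : Set
Pairs = List (ℕ × ℕ)

elems : Pairs → List ℕ
elems = concatMap (λ { (s , t) → s ∷ t ∷ [] })

diffs : ℕ → Pairs → List ℕ
diffs n = concatMap (λ { (s , t) → subₙ n s t ∷ subₙ n t s ∷ [] })

sums : ℕ → Pairs → List ℕ
sums n = map (λ { (s , t) → addₙ n s t })

pmSums : ℕ → Pairs → List ℕ
pmSums n = concatMap (λ { (s , t) → addₙ n s t ∷ negₙ n (addₙ n s t) ∷ [] })

IsStarter : ℕ → Pairs → Set
IsStarter n P = (elems P ↭ nonzeroₙ n) × (diffs n P ↭ nonzeroₙ n)

IsStrong : ℕ → Pairs → Set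
IsStrong n P = IsStarter n P × All (λ x → x ≢ 0) (sums n P) × Unique (sums n P)

IsSkew : ℕ → Pairs → Set
IsSkew n P = IsStrong n P × (pmSums n P ↭ nonzeroₙ n)

CardioidalPair : ℕ → ℕ × ℕ → Set
CardioidalPair n (s , t) =
  ∃ λ i → i < n × i ≢ 0 ×
    ((s ≡ i × t ≡ mod (2 * i) n) ⊎ (s ≡ mod (2 * i) n × t ≡ i))

IsCardioidal : ℕ → Pairs → Set
IsCardioidal n P = IsStarter n P × All (CardioidalPair n) P

-- In a pair {i, 2i} the differences are ±i and the sums are ±3i, so the ±sums of a
-- cardioidal starter are its ±differences multiplied by 3.  The ±differences are
-- ℤ_n ∖ {0}, and when 3 ∤ n multiplication by 3 permutes ℤ_n ∖ {0}; so the ±sums are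
-- again ℤ_n ∖ {0}, which in particular makes the sums non-zero and distinct.
module Submission where

open import Defs
open import Level using (0ℓ)
open import Data.Nat using (ℕ; zero; suc; _+_; _*_; _∸_; _<_; _≤_; z≤n; s≤s)
open import Data.Nat.Properties
open import Data.Nat.DivMod
open import Data.Nat.Divisibility using (_∣_; divides)
open import Data.Nat.Tactic.RingSolver using (solve-∀)
open import Data.List using (List; []; _∷_; map)
open import Data.List.Relation.Unary.All as All using (All; []; _∷_)
open import Data.List.Relation.Unary.All.Properties using () renaming (map⁺ to All-map⁺)
open import Data.List.Relation.Unary.Unique.Propositional using (Unique; []; _∷_)
import Data.List.Relation.Unary.Unique.Propositional.Properties as Unique
open import Data.List.Relation.Binary.Sublist.Propositional using (_⊆_; []; _∷_; _∷ʳ_)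
open import Data.List.Relation.Binary.Sublist.Propositional.Properties using (All-resp-⊆)
open import Data.List.Relation.Binary.Permutation.Propositional
  using (_↭_; prep; swap; ↭-sym; ↭⇒↭ₛ; module PermutationReasoning) renaming (refl to ↭-refl)
open import Data.List.Relation.Binary.Permutation.Propositional.Properties using (All-resp-↭; map⁺)
import Data.List.Relation.Binary.Permutation.Setoid.Properties as Permutationₛ
open import Data.List.Membership.Propositional using (_∈_)
open import Data.List.Membership.Propositional.Properties using (∈-map⁺; ∈-map⁻; ∈-upTo⁺; ∈-upTo⁻)
open import Data.List.Membership.Propositional.Properties.WithK using (unique∧set⇒bag)
open import Data.List.Relation.Binary.BagAndSetEquality using (∼bag⇒↭)
open import Data.Product using (Σ; _×_; _,_; proj₁; proj₂)
open import Data.Sum using (inj₁; inj₂)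
open import Data.Empty using (⊥-elim)
open import Function.Bundles using (mk⇔)
open import Relation.Nullary using (¬_)
open import Relation.Binary.Bundles using (Setoid)
open import Relation.Binary.Structures using (IsEquivalence)
open import Relation.Binary.PropositionalEquality as ≡
  using (_≡_; _≢_; refl; cong; cong₂; subst)

Unique-resp-⊇ : ∀ {A : Set} {xs ys : List A} → xs ⊆ ys → Unique ys → Unique xs
Unique-resp-⊇ []          []       = []
Unique-resp-⊇ (_ ∷ʳ p)    (_ ∷ u)  = Unique-resp-⊇ p u
Unique-resp-⊇ (refl ∷ p)  (a ∷ u)  = All-resp-⊆ p a ∷ Unique-resp-⊇ p u

Unique-resp-↭ : ∀ {A : Set} {xs ys : List A} → xs ↭ ys → Unique xs → Unique ys
Unique-resp-↭ {A} p = Permutationₛ.Unique-resp-↭ (≡.setoid A) (↭⇒↭ₛ p)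

sums⊆pmSums : ∀ n (P : Pairs) → sums n P ⊆ pmSums n P
sums⊆pmSums n []            = []
sums⊆pmSums n ((s , t) ∷ P) = refl ∷ (_ ∷ʳ sums⊆pmSums n P)

Unique-map⁺-on : ∀ {A B : Set} {P : A → Set} {f : A → B} {xs} →
  (∀ {x y} → P x → P y → f x ≡ f y → x ≡ y) → All P xs → Unique xs → Unique (map f xs)
Unique-map⁺-on inj []         []        = []
Unique-map⁺-on inj (px ∷ pxs) (x∉ ∷ u)  =
  All-map⁺ (All.zipWith (λ (py , x≢y) fx≡fy → x≢y (inj px py fx≡fy)) (pxs , x∉))
    ∷ Unique-map⁺-on inj pxs u

-- Congruence modulo N = suc m, so that no NonZero instance is needed and mod a N
-- computes to a % N.
module Modulo (m : ℕ) where

  N : ℕ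
  N = suc m

  infix 4 _≈_
  record _≈_ (a b : ℕ) : Set where
    constructor mk≈
    field %-≡ : a % N ≡ b % N
  open _≈_ public

  ≈-isEquivalence : IsEquivalence _≈_
  ≈-isEquivalence = record
    { refl  = mk≈ refl
    ; sym   = λ (mk≈ p) → mk≈ (≡.sym p)
    ; trans = λ (mk≈ p) (mk≈ q) → mk≈ (≡.trans p q)
    }

  ≈-setoid : Setoid 0ℓ 0ℓ
  ≈-setoid = record { isEquivalence = ≈-isEquivalence }

  open Setoid ≈-setoid public using () renaming (refl to ≈-refl; sym to ≈-sym; trans to ≈-trans)
  open import Relation.Binary.Reasoning.Setoid ≈-setoid

  %-≈ : ∀ a → a % N ≈ a
  %-≈ a = mk≈ (m%n%n≡m%n a N)

  ≡⇒≈ : ∀ {a b} → a ≡ b → a ≈ b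
  ≡⇒≈ p = mk≈ (cong (_% N) p)

  ≈⇒≡ : ∀ {a b} → a < N → b < N → a ≈ b → a ≡ b
  ≈⇒≡ a<N b<N (mk≈ p) = ≡.trans (≡.sym (m<n⇒m%n≡m a<N)) (≡.trans p (m<n⇒m%n≡m b<N))

  +-cong : ∀ {a b c d} → a ≈ b → c ≈ d → a + c ≈ b + d
  +-cong {a} {b} {c} {d} (mk≈ p) (mk≈ q) = mk≈ (≡.trans (%-distribˡ-+ a c N)
    (≡.trans (cong₂ (λ x y → (x + y) % N) p q) (≡.sym (%-distribˡ-+ b d N))))

  *-cong : ∀ {a b c d} → a ≈ b → c ≈ d → a * c ≈ b * d
  *-cong {a} {b} {c} {d} (mk≈ p) (mk≈ q) = mk≈ (≡.trans (%-distribˡ-* a c N)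
    (≡.trans (cong₂ (λ x y → (x * y) % N) p q) (≡.sym (%-distribˡ-* b d N))))

  ∸-+-≈-0 : ∀ {c} → c ≤ N → N ∸ c + c ≈ 0
  ∸-+-≈-0 c≤N = ≈-trans (≡⇒≈ (m∸n+n≡m c≤N)) (mk≈ (n%n≡0 N))

  +-inverseʳ : ∀ c → c + (N ∸ c % N) ≈ 0
  +-inverseʳ c = begin
    c + (N ∸ c % N)      ≈⟨ +-cong (≈-sym (%-≈ c)) ≈-refl ⟩
    c % N + (N ∸ c % N)  ≡⟨ +-comm (c % N) _ ⟩
    N ∸ c % N + c % N    ≈⟨ ∸-+-≈-0 (m%n≤n c N) ⟩
    0                    ∎

  +-cancelʳ-≈ : ∀ a b c → a + c ≈ b + c → a ≈ b
  +-cancelʳ-≈ a b c a+c≈b+c = begin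
    a                      ≡⟨ +-identityʳ a ⟨
    a + 0                  ≈⟨ +-cong (≈-refl {a}) (+-inverseʳ c) ⟨
    a + (c + c′)           ≡⟨ +-assoc a c c′ ⟨
    a + c + c′             ≈⟨ +-cong a+c≈b+c ≈-refl ⟩
    b + c + c′             ≡⟨ +-assoc b c c′ ⟩
    b + (c + c′)           ≈⟨ +-cong (≈-refl {b}) (+-inverseʳ c) ⟩
    b + 0                  ≡⟨ +-identityʳ b ⟩
    b                      ∎
    where
    c′ : ℕ
    c′ = N ∸ c % N

  ≈-∸ : ∀ {a c} → c ≤ N → a + c ≈ 0 → a ≈ N ∸ c
  ≈-∸ {a} {c} c≤N a+c≈0 = +-cancelʳ-≈ a (N ∸ c) c (≈-trans a+c≈0 (≈-sym (∸-+-≈-0 c≤N)))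

  subₙ-+ : ∀ a {b} → b ≤ N → subₙ N a b + b ≈ a
  subₙ-+ a {b} b≤N = begin
    subₙ N a b + b         ≈⟨ +-cong (≈-trans (%-≈ _) (+-cong (≈-refl {a}) (%-≈ (N ∸ b)))) ≈-refl ⟩
    a + (N ∸ b) + b        ≡⟨ +-assoc a (N ∸ b) b ⟩
    a + (N ∸ b + b)        ≈⟨ +-cong (≈-refl {a}) (∸-+-≈-0 b≤N) ⟩
    a + 0                  ≡⟨ +-identityʳ a ⟩
    a                      ∎

  ∈-nonzeroₙ⁺ : ∀ {y} → 0 < y → y < N → y ∈ nonzeroₙ N
  ∈-nonzeroₙ⁺ {suc y} _ (s≤s y<m) = ∈-map⁺ suc (∈-upTo⁺ y<m)

  ∈-nonzeroₙ⁻ : ∀ {y} → y ∈ nonzeroₙ N → 0 < y × y < N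
  ∈-nonzeroₙ⁻ y∈ with ∈-map⁻ suc y∈
  ... | _ , y′∈ , refl = s≤s z≤n , s≤s (∈-upTo⁻ y′∈)

  nonzeroₙ-unique : Unique (nonzeroₙ N)
  nonzeroₙ-unique = Unique.map⁺ suc-injective (Unique.upTo⁺ m)

  scaleₙ : ℕ → ℕ → ℕ
  scaleₙ a x = a * x % N

  scaleₙ-zeroʳ : ∀ a → scaleₙ a 0 ≡ 0
  scaleₙ-zeroʳ a = cong (_% N) (*-zeroʳ a)

  module _ {a b : ℕ} (a*b≈1 : a * b ≈ 1) where

    b*[a*x]≈x : ∀ x → b * (a * x) ≈ x
    b*[a*x]≈x x = begin
      b * (a * x)          ≡⟨ *-assoc b a x ⟨
      b * a * x            ≡⟨ cong (_* x) (*-comm b a) ⟩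
      a * b * x            ≈⟨ *-cong a*b≈1 (≈-refl {x}) ⟩
      1 * x                ≡⟨ *-identityˡ x ⟩
      x                    ∎

    scaleₙ-injective : ∀ {x y} → x < N → y < N → scaleₙ a x ≡ scaleₙ a y → x ≡ y
    scaleₙ-injective {x} {y} x<N y<N ax≡ay = ≈⇒≡ x<N y<N (begin
      x                    ≈⟨ b*[a*x]≈x x ⟨
      b * (a * x)          ≈⟨ *-cong (≈-refl {b}) (mk≈ ax≡ay) ⟩
      b * (a * y)          ≈⟨ b*[a*x]≈x y ⟩
      y                    ∎)

    scaleₙ-inverse : ∀ {y} → y < N → scaleₙ a (scaleₙ b y) ≡ y
    scaleₙ-inverse {y} y<N = ≡.trans (%-≡ (begin
      a * (b * y % N)      ≈⟨ *-cong (≈-refl {a}) (%-≈ (b * y)) ⟩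
      a * (b * y)          ≡⟨ *-assoc a b y ⟨
      a * b * y            ≈⟨ *-cong a*b≈1 (≈-refl {y}) ⟩
      1 * y                ≡⟨ *-identityˡ y ⟩
      y                    ∎)) (m<n⇒m%n≡m y<N)

    scaleₙ-≢0 : ∀ {x} → 0 < x → x < N → scaleₙ a x ≢ 0
    scaleₙ-≢0 {x} 0<x x<N ax≡0 = <⇒≢ 0<x (≡.sym (scaleₙ-injective x<N (s≤s z≤n)
      (≡.trans ax≡0 (≡.sym (scaleₙ-zeroʳ a)))))

    scaleₙ-nonzeroₙ↭ : map (scaleₙ a) (nonzeroₙ N) ↭ nonzeroₙ N
    scaleₙ-nonzeroₙ↭ = ∼bag⇒↭ (unique∧set⇒bag image-unique nonzeroₙ-unique (mk⇔ ⊆-nonzeroₙ ⊇-nonzeroₙ))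
      where
      image-unique : Unique (map (scaleₙ a) (nonzeroₙ N))
      image-unique = Unique-map⁺-on scaleₙ-injective
        (All.tabulate (λ y∈ → proj₂ (∈-nonzeroₙ⁻ y∈))) nonzeroₙ-unique
      ⊆-nonzeroₙ : ∀ {y} → y ∈ map (scaleₙ a) (nonzeroₙ N) → y ∈ nonzeroₙ N
      ⊆-nonzeroₙ y∈ with ∈-map⁻ (scaleₙ a) y∈
      ... | x , x∈ , refl with ∈-nonzeroₙ⁻ x∈
      ... | 0<x , x<N = ∈-nonzeroₙ⁺ (n≢0⇒n>0 (scaleₙ-≢0 0<x x<N)) (m%n<n (a * x) N)
      ⊇-nonzeroₙ : ∀ {y} → y ∈ nonzeroₙ N → y ∈ map (scaleₙ a) (nonzeroₙ N)
      ⊇-nonzeroₙ {y} y∈ with ∈-nonzeroₙ⁻ y∈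
      ... | 0<y , y<N = subst (_∈ map (scaleₙ a) (nonzeroₙ N)) (scaleₙ-inverse y<N)
          (∈-map⁺ (scaleₙ a) (∈-nonzeroₙ⁺ (n≢0⇒n>0 by≢0) (m%n<n (b * y) N)))
        where
        by≢0 : scaleₙ b y ≢ 0
        by≢0 by≡0 = <⇒≢ 0<y (≡.sym (≡.trans (≡.sym (scaleₙ-inverse y<N))
          (≡.trans (cong (scaleₙ a) by≡0) (scaleₙ-zeroʳ a))))

  3-invertible : ¬ (3 ∣ N) → Σ ℕ λ k → 3 * k ≈ 1
  3-invertible 3∤N with N % 3 | m≡m%n+[m/n]*n N 3 | m%n<n N 3
  ... | 0 | N≡q*3 | _ = ⊥-elim (3∤N (divides (N / 3) N≡q*3))
  ... | 1 | N≡1+q*3 | _ = 2 * (N / 3) + 1 , (begin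
    3 * (2 * (N / 3) + 1)      ≡⟨ 3*[2q+1]≡1+2*[1+q*3] (N / 3) ⟩
    1 + 2 * (1 + N / 3 * 3)    ≡⟨ cong (λ z → 1 + 2 * z) N≡1+q*3 ⟨
    1 + 2 * N                  ≈⟨ mk≈ ([m+kn]%n≡m%n 1 2 N) ⟩
    1                          ∎)
    where
    3*[2q+1]≡1+2*[1+q*3] : ∀ q → 3 * (2 * q + 1) ≡ 1 + 2 * (1 + q * 3)
    3*[2q+1]≡1+2*[1+q*3] = solve-∀
  ... | 2 | N≡2+q*3 | _ = N / 3 + 1 , (begin
    3 * (N / 3 + 1)            ≡⟨ 3*[q+1]≡1+[2+q*3] (N / 3) ⟩
    1 + (2 + N / 3 * 3)        ≡⟨ cong (1 +_) N≡2+q*3 ⟨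
    1 + N                      ≈⟨ mk≈ ([m+n]%n≡m%n 1 N) ⟩
    1                          ∎)
    where
    3*[q+1]≡1+[2+q*3] : ∀ q → 3 * (q + 1) ≡ 1 + (2 + q * 3)
    3*[q+1]≡1+[2+q*3] = solve-∀
  ... | suc (suc (suc _)) | _ | s≤s (s≤s (s≤s ()))

  3*[2i-i]≡i+2i : ∀ {i} → i ≤ N → scaleₙ 3 (subₙ N (2 * i % N) i) ≡ addₙ N i (2 * i % N)
  3*[2i-i]≡i+2i {i} i≤N = %-≡ (begin
    3 * d                  ≈⟨ *-cong (≈-refl {3}) d≈i ⟩
    3 * i                  ≡⟨⟩
    i + 2 * i              ≈⟨ +-cong (≈-refl {i}) (%-≈ (2 * i)) ⟨
    i + x                  ∎)
    where
    x d : ℕ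
    x = 2 * i % N
    d = subₙ N x i
    d≈i : d ≈ i
    d≈i = +-cancelʳ-≈ d i i (begin
      d + i                ≈⟨ subₙ-+ x i≤N ⟩
      x                    ≈⟨ %-≈ (2 * i) ⟩
      2 * i                ≡⟨ cong (i +_) (+-identityʳ i) ⟩
      i + i                ∎)

  3*[i-2i]≡-[i+2i] : ∀ {i} → scaleₙ 3 (subₙ N i (2 * i % N)) ≡ negₙ N (addₙ N i (2 * i % N))
  3*[i-2i]≡-[i+2i] {i} = %-≡ (≈-∸ (m%n≤n (i + x) N) (begin
    3 * d + (i + x) % N    ≈⟨ +-cong (≈-refl {3 * d}) (%-≈ (i + x)) ⟩
    3 * d + (i + x)        ≈⟨ +-cong (≈-refl {3 * d}) (+-cong (≈-refl {i}) (%-≈ (2 * i))) ⟩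
    3 * d + (i + 2 * i)    ≡⟨ *-distribˡ-+ 3 d i ⟨
    3 * (d + i)            ≈⟨ *-cong (≈-refl {3}) d+i≈0 ⟩
    0                      ∎))
    where
    x d : ℕ
    x = 2 * i % N
    d = subₙ N i x
    d+i≈0 : d + i ≈ 0
    d+i≈0 = +-cancelʳ-≈ (d + i) 0 i (begin
      d + i + i            ≡⟨ +-assoc d i i ⟩
      d + (i + i)          ≡⟨ cong (λ j → d + (i + j)) (+-identityʳ i) ⟨
      d + 2 * i            ≈⟨ +-cong (≈-refl {d}) (%-≈ (2 * i)) ⟨
      d + x                ≈⟨ subₙ-+ i (m%n≤n (2 * i) N) ⟩
      i                    ∎)

  pmSums↭3*diffs : ∀ P → All (CardioidalPair N) P → pmSums N P ↭ map (scaleₙ 3) (diffs N P)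
  pmSums↭3*diffs [] [] = ↭-refl
  pmSums↭3*diffs ((s , t) ∷ P) ((i , i<N , _ , inj₁ (refl , refl)) ∷ cs)
    rewrite 3*[2i-i]≡i+2i (<⇒≤ i<N)
          | 3*[i-2i]≡-[i+2i] {i} = swap _ _ (pmSums↭3*diffs P cs)
  pmSums↭3*diffs ((s , t) ∷ P) ((i , i<N , _ , inj₂ (refl , refl)) ∷ cs)
    rewrite +-comm (2 * i % N) i
          | 3*[2i-i]≡i+2i (<⇒≤ i<N)
          | 3*[i-2i]≡-[i+2i] {i} = prep _ (prep _ (pmSums↭3*diffs P cs))

theorem4 : (n : ℕ) → 3 ≤ n → ¬ (2 ∣ n) → ¬ (3 ∣ n) →
    (P : Pairs) → IsCardioidal n P → IsSkew n P
theorem4 zero    () _ _ _ _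
theorem4 (suc m) _ _ 3∤n P (starter@(_ , diffs↭nonzero) , cardioidal) =
  (starter , All-resp-⊆ sums⊆ pmSums≢0 , Unique-resp-⊇ sums⊆ pmSums-unique) , pmSums↭nonzero
  where
  open Modulo m
  sums⊆ : sums N P ⊆ pmSums N P
  sums⊆ = sums⊆pmSums N P

  3⁻¹ : Σ ℕ λ k → 3 * k ≈ 1
  3⁻¹ = 3-invertible 3∤n

  pmSums↭nonzero : pmSums N P ↭ nonzeroₙ N
  pmSums↭nonzero = begin
    pmSums N P                         ↭⟨ pmSums↭3*diffs P cardioidal ⟩
    map (scaleₙ 3) (diffs N P)         ↭⟨ map⁺ (scaleₙ 3) diffs↭nonzero ⟩
    map (scaleₙ 3) (nonzeroₙ N)        ↭⟨ scaleₙ-nonzeroₙ↭ {3} {proj₁ 3⁻¹} (proj₂ 3⁻¹) ⟩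
    nonzeroₙ N                         ∎
    where open PermutationReasoning

  pmSums-unique : Unique (pmSums N P)
  pmSums-unique = Unique-resp-↭ (↭-sym pmSums↭nonzero) nonzeroₙ-unique

  pmSums≢0 : All (_≢ 0) (pmSums N P)
  pmSums≢0 = All-resp-↭ (↭-sym pmSums↭nonzero)
    (All.tabulate (λ y∈ y≡0 → <⇒≢ (proj₁ (∈-nonzeroₙ⁻ y∈)) (≡.sym y≡0)))
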